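{- For every integer $h\ge1$, with $m=\lfloor h/2\rfloor$, the map \[F:\mathrm{d}\mapsto\big(\mathrm{d}^{\mathrm{fix}},\mathrm{d}^{\mathrm{free}},((\epsilon_j(\mathrm{d}),\mathrm{d}^{\mathrm{spn}}_j);1\le j\le\ell(\mathrm{d}))\big)\] is a bijection from $\mathcal{D}_h$ onto \[\mathcal{D}_h':=\mathcal{D}_{h-m-1}\times\bigcup_{k=m}^{h-1}\mathcal{D}_k\times\bigcup_{\ell\ge0}\Big(\big(\{ -1\}\times\bigcup_{k=0}^{\lfloor h/2\rfloor-1}\mathcal{D}_k\big)\cup\big(\{1\}\times\bigcup_{k=0}^{\lceil h/2\rceil-1}\mathcal{D}_k\big)\Big)^\ell.\]
   Context: Write $[\![j,k]\!]=\{j,\dots,k\}$. A Dyck path of length $2n$ is $\mathrm{d}:[\![0,2n]\!]\to\mathbb{Z}_{\ge0}$ with $\mathrm{d}(0)=\mathrm{d}(2n)=0$ and $|\mathrm{d}(i)-\mathrm{d}(i-1)|=1$; height $\|\mathrm{d}\|=\max_i\mathrm{d}(i)$; $\mathcal{D}_h$ is the set of all Dyck paths (of any length) with height $h$. Decomposition of $\mathrm{d}$ of length $2n$, height $h\ge1$, $m=\lfloor h/2\rfloor$: $\sigma_{\max}=\min\{i:\mathrm{d}(i)=h\}$, $\sigma_g=\max\{i\in[\![0,\sigma_{\max}]\!]:\mathrm{d}(i)=m\}$, $\sigma_d=\min\{i\in[\![\sigma_{\max},2n]\!]:\mathrm{d}(i)=m\}$, $\sigma_{\mathrm{last}}=\max\{i\in[\![\sigma_{\max},2n]\!]:\mathrm{d}(i)=m\}$;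 list $\{i\in[\![\sigma_d,\sigma_{\mathrm{last}}]\!]:\mathrm{d}(i)=m\}$ increasingly as $\sigma_d=\rho_1<\dots<\rho_\ell<\rho_{\ell+1}=\sigma_{\mathrm{last}}$, defining $\ell(\mathrm{d})=\ell\ge0$. Define Dyck paths $\mathrm{d}^{\mathrm{fix}}(i)=\mathrm{d}(\sigma_g+1+i)-m-1$ for $i\in[\![0,\sigma_d-\sigma_g-2]\!]$; $\mathrm{d}^{\mathrm{free}}(i)=\mathrm{d}(i)$ for $i\in[\![0,\sigma_g]\!]$ and $\mathrm{d}^{\mathrm{free}}(i)=\mathrm{d}(\sigma_{\mathrm{last}}+i-\sigma_g)$ for $i\in[\![\sigma_g+1,2n-(\sigma_{\mathrm{last}}-\sigma_g)]\!]$; for $j\in[\![1,\ell]\!]$, $\mathrm{d}^{\mathrm{spn}}_j(i)=|\mathrm{d}(\rho_j+1+i)-m|-1$ for $i\in[\![0,\rho_{j+1}-\rho_j-2]\!]$, and $\epsilon_j(\mathrm{d})=\mathrm{d}(\rho_j+1)-\mathrm{d}(\rho_j)\in\{ -1,1\}$. In the product, $X^0$ is the one-element set containing the empty sequence. -}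

module Defs where

open import Data.Nat using (ℕ; zero; suc; _+_; _∸_; _⊔_; _≤_; _<_; _≡ᵇ_; _≤ᵇ_; ⌊_/2⌋; ⌈_/2⌉; ∣_-_∣)
open import Data.Integer as ℤ using (ℤ; +_; -[1+_])
open import Data.Bool using (Bool; _∧_)
open import Data.List using (List; []; _∷_; _++_; map; take; drop; length; zip; upTo; filterᵇ; foldr; head; last)
open import Data.List.Relation.Unary.All using (All)
open import Data.Maybe using (Maybe; just; nothing)
open import Data.Product using (Σ; _×_; _,_; proj₁; proj₂)
open import Data.Sum using (_⊎_)
open import Data.Unit using (⊤)
open import Relation.Binary.PropositionalEquality using (_≡_)

-- A path d : [0,2n] → ℕ is represented by the list of its values
-- [ d(0) , d(1) , … , d(2n) ].

Steps : List ℕ → Set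
Steps []            = ⊤
Steps (x ∷ [])      = ⊤
Steps (x ∷ y ∷ r)   = (y ≡ suc x ⊎ x ≡ suc y) × Steps (y ∷ r)

IsDyck : List ℕ → Set
IsDyck d = (head d ≡ just 0) × (last d ≡ just 0) × Steps d

height : List ℕ → ℕ
height = foldr _⊔_ 0

InD : ℕ → List ℕ → Set
InD h d = IsDyck d × height d ≡ h

indicesWhere : (ℕ → Bool) → List ℕ → List ℕ
indicesWhere p d = map proj₁ (filterᵇ (λ q → p (proj₂ q)) (zip (upTo (length d)) d))

headOr0 : List ℕ → ℕ
headOr0 []      = 0
headOr0 (x ∷ _) = x

lastOr0 : List ℕ → ℕ
lastOr0 []           = 0
lastOr0 (x ∷ [])     = x
lastOr0 (_ ∷ y ∷ r)  = lastOr0 (y ∷ r)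

-- slice d a b = [ d(a) , … , d(b) ]   (empty if b < a)
slice : List ℕ → ℕ → ℕ → List ℕ
slice d a b = take (suc b ∸ a) (drop a d)

consecPairs : List ℕ → List (ℕ × ℕ)
consecPairs []            = []
consecPairs (x ∷ [])      = []
consecPairs (x ∷ y ∷ r)   = (x , y) ∷ consecPairs (y ∷ r)

-- value d(i) (0 outside the domain; only used inside the domain)
at : List ℕ → ℕ → ℕ
at d i = headOr0 (drop i d)

module Decomp (h : ℕ) (d : List ℕ) where
  m : ℕ
  m = ⌊ h /2⌋

  mIdx : List ℕ
  mIdx = indicesWhere (λ x → x ≡ᵇ m) d

  σmax : ℕ
  σmax = headOr0 (indicesWhere (λ x → x ≡ᵇ h) d)

  σg : ℕ
  σg = lastOr0 (filterᵇ (λ i → i ≤ᵇ σmax) mIdx)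

  σd : ℕ
  σd = headOr0 (filterᵇ (λ i → σmax ≤ᵇ i) mIdx)

  σlast : ℕ
  σlast = lastOr0 (filterᵇ (λ i → σmax ≤ᵇ i) mIdx)

  ρs : List ℕ
  ρs = filterᵇ (λ i → (σd ≤ᵇ i) ∧ (i ≤ᵇ σlast)) mIdx

  dfix : List ℕ
  dfix = map (λ x → x ∸ suc m) (slice d (suc σg) (σd ∸ 1))

  dfree : List ℕ
  dfree = slice d 0 σg ++ drop (suc σlast) d

  eps : ℕ × ℕ → ℤ
  eps (a , b) = (+ at d (suc a)) ℤ.- (+ at d a)

  spn : ℕ × ℕ → List ℕ
  spn (a , b) = map (λ x → ∣ x - m ∣ ∸ 1) (slice d (suc a) (b ∸ 1))

  excursions : List (ℤ × List ℕ)
  excursions = map (λ p → eps p , spn p) (consecPairs ρs)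

F : ℕ → List ℕ → List ℕ × List ℕ × List (ℤ × List ℕ)
F h d = Decomp.dfix h d , Decomp.dfree h d , Decomp.excursions h d

InLetter : ℕ → ℤ × List ℕ → Set
InLetter h (e , p) =
  (e ≡ -[1+ 0 ] × IsDyck p × height p < ⌊ h /2⌋)
  ⊎ (e ≡ + 1 × IsDyck p × height p < ⌈ h /2⌉)

InD' : ℕ → List ℕ × List ℕ × List (ℤ × List ℕ) → Set
InD' h (fx , fr , ws) =
  InD (h ∸ ⌊ h /2⌋ ∸ 1) fx
  × (IsDyck fr × ⌊ h /2⌋ ≤ height fr × height fr < h)
  × All (InLetter h) ws

-- With m = ⌊h/2⌋, a Dyck path d of height h factors as
--   d = P ++ m ∷ X ++ m ∷ E₁ ++ m ∷ … ++ m ∷ Eₗ ++ m ∷ S ,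
-- where X is the excursion above m containing the first visit to h, each Eⱼ is an excursion
-- strictly above or strictly below m, and S stays below m; the factorization exists because a
-- path cannot cross a level without visiting it, and it is unique given these constraints.
-- F reads the pieces off: d^fix is X lowered by m+1, d^free is P ++ m ∷ S, and Eⱼ becomes its
-- direction together with the Dyck path obtained by lowering it (above m) or reflecting it
-- (below m).  These maps are invertible on the relevant paths and the height bounds defining
-- 𝒟′_h are exactly those of the pieces, so F is a bijection.

module Submission where

open import Defs
open import Data.Nat using (ℕ; suc; _+_; _∸_; _≤_; _<_; _≡ᵇ_; _≤ᵇ_; ⌊_/2⌋; ⌈_/2⌉; ∣_-_∣; z≤n; z<s; s≤s; s≤s⁻¹)
open import Data.Nat.Properties
open import Data.Integer as ℤ using (ℤ; +_; -[1+_])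
import Data.Integer.Properties as ℤ
open import Data.Bool using (Bool; true; false; _∧_; T; if_then_else_)
open import Data.Bool.Properties using (T-∧)
open import Data.List using (List; []; _∷_; [_]; _++_; _∷ʳ_; map; take; drop; length; zip; applyUpTo; filterᵇ; foldr; head; last)
open import Data.List.Properties using (∷-injective; ++-assoc; length-++; ++-identityʳ; map-∘; map-id-local; map-cong-local; last-map; filter-all; filter-none; filter-++)
open import Data.List.Relation.Unary.All as All using (All; []; _∷_)
open import Data.List.Relation.Unary.All.Properties as All using ()
open import Data.List.Relation.Unary.Any as Any using (Any; here; there)
open import Data.List.Membership.Propositional using (_∈_)
open import Data.List.Membership.Propositional.Properties using (∈-map⁺; ∈-++⁺ʳ; ∈-++⁺ˡ)
open import Data.Maybe as Maybe using (just)
open import Data.Product using (Σ; Σ-syntax; _×_; _,_; proj₁; proj₂; map₁)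
open import Data.Sum using (_⊎_; inj₁; inj₂; swap)
open import Data.Unit using (tt)
open import Data.Empty using (⊥-elim)
open import Function using (_∘_; id; Equivalence)
open import Relation.Binary.Definitions using (DecidableEquality)
open import Relation.Binary.PropositionalEquality hiding ([_])
open import Relation.Nullary using (¬_; yes; no; contradiction)
open import Relation.Nullary.Decidable using (T?)

module _ {A : Set} where

  Avoids : A → List A → Set
  Avoids a = All (_≢ a)

  splice : A → List (List A) → List A → List A
  splice a Es S = foldr (λ E r → E ++ a ∷ r) S Es

  head-++-∷ : ∀ (xs : List A) {y} ys zs → head (xs ++ y ∷ ys) ≡ head (xs ++ y ∷ zs)
  head-++-∷ []       ys zs = refl
  head-++-∷ (x ∷ xs) ys zs = refl

  last-++-∷ : ∀ (xs : List A) {y} ys → last (xs ++ y ∷ ys) ≡ last (y ∷ ys)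
  last-++-∷ []           ys = refl
  last-++-∷ (x ∷ [])     ys = refl
  last-++-∷ (x ∷ x′ ∷ xs) ys = last-++-∷ (x′ ∷ xs) ys

  head⇒∈ : ∀ (xs : List A) {v} → head xs ≡ just v → v ∈ xs
  head⇒∈ (x ∷ xs) refl = here refl

  last⇒∈ : ∀ (xs : List A) {v} → last xs ≡ just v → v ∈ xs
  last⇒∈ (x ∷ [])     refl = here refl
  last⇒∈ (x ∷ x′ ∷ xs) eq   = there (last⇒∈ (x′ ∷ xs) eq)

  last-splice : ∀ a Es S → last (a ∷ splice a Es S) ≡ last (a ∷ S)
  last-splice a []       S = refl
  last-splice a (E ∷ Es) S = trans (last-++-∷ (a ∷ E) (splice a Es S)) (last-splice a Es S)

  All-splice⁺ : ∀ {P : A → Set} {a Es S} → P a → All (All P) Es → All P S → All P (splice a Es S)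
  All-splice⁺ pa []         pS = pS
  All-splice⁺ pa (pE ∷ pEs) pS = All.++⁺ pE (pa ∷ All-splice⁺ pa pEs pS)

  All-splice⁻ : ∀ {P : A → Set} a Es {S} → All P (splice a Es S) → All (All P) Es × All P S
  All-splice⁻ a []       pS = [] , pS
  All-splice⁻ a (E ∷ Es) p with All.++⁻ E p
  ... | pE , _ ∷ p′ with All-splice⁻ a Es p′
  ...   | pEs , pS = pE ∷ pEs , pS

  length-++-∷ : ∀ (xs : List A) {y} ys → length (xs ++ y ∷ ys) ≡ suc (length xs) + length ys
  length-++-∷ xs ys = trans (length-++ xs) (+-suc (length xs) (length ys))

  drop-length-++ : ∀ (xs : List A) {ys} → drop (length xs) (xs ++ ys) ≡ ys
  drop-length-++ []       = refl
  drop-length-++ (x ∷ xs) = drop-length-++ xs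

  take-length-++ : ∀ (xs : List A) {ys} → take (length xs) (xs ++ ys) ≡ xs
  take-length-++ []       = refl
  take-length-++ (x ∷ xs) = cong (x ∷_) (take-length-++ xs)

  drop-suc-length : ∀ (xs : List A) {y ys} → drop (suc (length xs)) (xs ++ y ∷ ys) ≡ ys
  drop-suc-length []       = refl
  drop-suc-length (x ∷ xs) = drop-suc-length xs

  take-suc-length : ∀ (xs : List A) {y ys} → take (suc (length xs)) (xs ++ y ∷ ys) ≡ xs ∷ʳ y
  take-suc-length []       = refl
  take-suc-length (x ∷ xs) = cong (x ∷_) (take-suc-length xs)

module _ {A : Set} (_≟_ : DecidableEquality A) where

  splitFirst : ∀ a L → Avoids a L ⊎ Σ[ B ∈ List A ] Σ[ C ∈ List A ] L ≡ B ++ a ∷ C × Avoids a B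
  splitFirst a [] = inj₁ []
  splitFirst a (x ∷ L) with x ≟ a | splitFirst a L
  ... | yes refl | _                          = inj₂ ([] , L , refl , [])
  ... | no x≢a   | inj₁ a∉L                   = inj₁ (x≢a ∷ a∉L)
  ... | no x≢a   | inj₂ (B , C , refl , a∉B) = inj₂ (x ∷ B , C , refl , x≢a ∷ a∉B)

  splitLast : ∀ a L → Avoids a L ⊎ Σ[ B ∈ List A ] Σ[ C ∈ List A ] L ≡ B ++ a ∷ C × Avoids a C
  splitLast a [] = inj₁ []
  splitLast a (x ∷ L) with splitLast a L | x ≟ a
  ... | inj₂ (B , C , refl , a∉C) | _        = inj₂ (x ∷ B , C , refl , a∉C)
  ... | inj₁ a∉L                  | yes refl = inj₂ ([] , L , refl , a∉L)
  ... | inj₁ a∉L                  | no x≢a   = inj₁ (x≢a ∷ a∉L)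

  splitOn : ∀ a L → Σ[ Es ∈ List (List A) ] Σ[ S ∈ List A ]
            L ≡ splice a Es S × All (Avoids a) Es × Avoids a S
  splitOn a [] = [] , [] , refl , [] , []
  splitOn a (x ∷ L) with splitOn a L | x ≟ a
  ... | Es , S , refl , a∉Es , a∉S      | yes refl = [] ∷ Es , S , refl , [] ∷ a∉Es , a∉S
  ... | [] , S , refl , [] , a∉S        | no x≢a   = [] , x ∷ S , refl , [] , x≢a ∷ a∉S
  ... | E ∷ Es , S , refl , a∉E ∷ a∉Es , a∉S | no x≢a =
    (x ∷ E) ∷ Es , S , refl , (x≢a ∷ a∉E) ∷ a∉Es , a∉S

++-∷-injective-avoiding : ∀ {A : Set} {a : A} B C B′ C′ → B ++ a ∷ C ≡ B′ ++ a ∷ C′ →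
                          Avoids a C → Avoids a C′ → B ≡ B′ × C ≡ C′
++-∷-injective-avoiding [] C [] C′ refl _ _ = refl , refl
++-∷-injective-avoiding [] C (b ∷ B′) C′ refl a∉C _ = contradiction refl (All.lookup a∉C (∈-++⁺ʳ B′ (here refl)))
++-∷-injective-avoiding (b ∷ B) C [] C′ refl _ a∉C′ = contradiction refl (All.lookup a∉C′ (∈-++⁺ʳ B (here refl)))
++-∷-injective-avoiding (b ∷ B) C (b′ ∷ B′) C′ eq a∉C a∉C′ with ∷-injective eq
... | refl , eq′ with ++-∷-injective-avoiding B C B′ C′ eq′ a∉C a∉C′
...   | refl , refl = refl , refl

map-inverse : ∀ {A B : Set} {f : A → B} {g : B → A} {P : A → Set} →
              (∀ {x} → P x → g (f x) ≡ x) → ∀ {xs} → All P xs → map g (map f xs) ≡ xs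
map-inverse inv {xs} pxs = trans (sym (map-∘ xs)) (map-id-local (All.map inv pxs))

map-cancel : ∀ {A B : Set} {f : A → B} {g : B → A} {P : A → Set} → (∀ {x} → P x → g (f x) ≡ x) →
             ∀ {xs ys} → All P xs → All P ys → map f xs ≡ map f ys → xs ≡ ys
map-cancel {g = g} inv pxs pys eq = trans (sym (map-inverse inv pxs)) (trans (cong (map g) eq) (map-inverse inv pys))

slice-between : ∀ (xs : List ℕ) {y} ys {zs} →
                slice (xs ++ y ∷ ys ++ zs) (suc (length xs)) (length xs + length ys) ≡ ys
slice-between xs {y} ys {zs} = begin
  take (suc (length xs + length ys) ∸ suc (length xs)) (drop (suc (length xs)) (xs ++ y ∷ ys ++ zs))
    ≡⟨ cong₂ take (m+n∸m≡n (length xs) (length ys)) (drop-suc-length xs) ⟩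
  take (length ys) (ys ++ zs)
    ≡⟨ take-length-++ ys ⟩
  ys ∎
  where open ≡-Reasoning

lastOr0-∷ʳ : ∀ xs a → lastOr0 (xs ∷ʳ a) ≡ a
lastOr0-∷ʳ []           a = refl
lastOr0-∷ʳ (x ∷ [])     a = refl
lastOr0-∷ʳ (x ∷ y ∷ xs) a = lastOr0-∷ʳ (y ∷ xs) a

Adjacent : ℕ → ℕ → Set
Adjacent x y = y ≡ suc x ⊎ x ≡ suc y

Adjacent-irrefl : ∀ {x} → ¬ Adjacent x x
Adjacent-irrefl (inj₁ eq) = 1+n≢n (sym eq)
Adjacent-irrefl (inj₂ eq) = 1+n≢n (sym eq)

Adjacent-above : ∀ {m x} → m < x → Adjacent m x → x ≡ suc m
Adjacent-above m<x (inj₁ eq)   = eq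
Adjacent-above m<x (inj₂ refl) = contradiction m<x (<-asym (n<1+n _))

Adjacent-below : ∀ {m x} → x < m → Adjacent m x → m ≡ suc x
Adjacent-below x<m (inj₂ eq)   = eq
Adjacent-below x<m (inj₁ refl) = contradiction x<m (<-asym (n<1+n _))

Steps-++⁺ : ∀ xs {y} ys → Steps (xs ∷ʳ y) → Steps (y ∷ ys) → Steps (xs ++ y ∷ ys)
Steps-++⁺ []            ys _        s = s
Steps-++⁺ (x ∷ [])      ys (a , _)  s = a , s
Steps-++⁺ (x ∷ x′ ∷ xs) ys (a , s₁) s = a , Steps-++⁺ (x′ ∷ xs) ys s₁ s

Steps-++⁻ : ∀ xs {y} ys → Steps (xs ++ y ∷ ys) → Steps (xs ∷ʳ y) × Steps (y ∷ ys)
Steps-++⁻ []            ys s       = tt , s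
Steps-++⁻ (x ∷ [])      ys (a , s) = (a , tt) , s
Steps-++⁻ (x ∷ x′ ∷ xs) ys (a , s) with Steps-++⁻ (x′ ∷ xs) ys s
... | s₁ , s₂ = (a , s₁) , s₂

Steps-prefix : ∀ xs ys → Steps (xs ++ ys) → Steps xs
Steps-prefix []            ys _       = tt
Steps-prefix (x ∷ [])      ys _       = tt
Steps-prefix (x ∷ x′ ∷ xs) ys (a , s) = a , Steps-prefix (x′ ∷ xs) ys s

Steps-∷ʳ : ∀ xs {y b} → Steps xs → last xs ≡ just y → Adjacent y b → Steps (xs ∷ʳ b)
Steps-∷ʳ (x ∷ [])      _       refl a = a , tt
Steps-∷ʳ (x ∷ x′ ∷ xs) (a₀ , s) eq  a = a₀ , Steps-∷ʳ (x′ ∷ xs) s eq a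

Steps-∷ʳ⁻ : ∀ x xs {b} → Steps ((x ∷ xs) ∷ʳ b) →
            Steps (x ∷ xs) × Σ[ y ∈ ℕ ] last (x ∷ xs) ≡ just y × Adjacent y b
Steps-∷ʳ⁻ x []        (a , _) = tt , x , refl , a
Steps-∷ʳ⁻ x (x′ ∷ xs) (a , s) with Steps-∷ʳ⁻ x′ xs s
... | s′ , y , eq , a′ = (a , s′) , y , eq , a′

Steps-map : ∀ (f : ℕ → ℕ) {Q : ℕ → Set} →
            (∀ {x y} → Q x → Q y → Adjacent x y → Adjacent (f x) (f y)) →
            ∀ {xs} → All Q xs → Steps xs → Steps (map f xs)
Steps-map f adj {[]}         _              _       = tt
Steps-map f adj {x ∷ []}     _              _       = tt
Steps-map f adj {x ∷ y ∷ xs} (qx ∷ qy ∷ qs) (a , s) = adj qx qy a , Steps-map f adj (qy ∷ qs) s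

Steps-splice⁺ : ∀ m Es {S} → All (λ E → Steps (m ∷ E ∷ʳ m)) Es → Steps (m ∷ S) → Steps (m ∷ splice m Es S)
Steps-splice⁺ m []       []         sS = sS
Steps-splice⁺ m (E ∷ Es) (sE ∷ sEs) sS = Steps-++⁺ (m ∷ E) (splice m Es _) sE (Steps-splice⁺ m Es sEs sS)

Steps-splice⁻ : ∀ m Es {S} → Steps (m ∷ splice m Es S) → All (λ E → Steps (m ∷ E ∷ʳ m)) Es × Steps (m ∷ S)
Steps-splice⁻ m []       s = [] , s
Steps-splice⁻ m (E ∷ Es) s with Steps-++⁻ (m ∷ E) (splice m Es _) s
... | sE , s′ with Steps-splice⁻ m Es s′
...   | sEs , sS = sE ∷ sEs , sS

stays-above : ∀ {m x} r → Steps (x ∷ r) → m < x → Avoids m r → All (m <_) r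
stays-above []      _                 _   _           = []
stays-above (y ∷ r) (inj₁ refl , s) m<x (_ ∷ m∉r)   =
  let m<y = m<n⇒m<1+n m<x in m<y ∷ stays-above r s m<y m∉r
stays-above (y ∷ r) (inj₂ refl , s) m<x (y≢m ∷ m∉r) =
  let m<y = ≤∧≢⇒< (s≤s⁻¹ m<x) (y≢m ∘ sym) in m<y ∷ stays-above r s m<y m∉r

stays-below : ∀ {m x} r → Steps (x ∷ r) → x < m → Avoids m r → All (_< m) r
stays-below []      _                 _   _           = []
stays-below (y ∷ r) (inj₁ refl , s) x<m (y≢m ∷ m∉r) =
  let y<m = ≤∧≢⇒< x<m y≢m in y<m ∷ stays-below r s y<m m∉r
stays-below (y ∷ r) (inj₂ refl , s) x<m (_ ∷ m∉r)   =
  let y<m = <-trans (n<1+n y) x<m in y<m ∷ stays-below r s y<m m∉r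

stays-on-one-side : ∀ {m} xs → Steps xs → Avoids m xs → All (m <_) xs ⊎ All (_< m) xs
stays-on-one-side []       _ _ = inj₁ []
stays-on-one-side {m} (x ∷ xs) s (x≢m ∷ m∉xs) with x <? m
... | yes x<m = inj₂ (x<m ∷ stays-below xs s x<m m∉xs)
... | no  x≮m = let m<x = ≤∧≢⇒< (≮⇒≥ x≮m) (x≢m ∘ sym) in inj₁ (m<x ∷ stays-above xs s m<x m∉xs)

leaves-on-one-side : ∀ m xs → Steps (m ∷ xs) → Avoids m xs → All (m <_) xs ⊎ All (_< m) xs
leaves-on-one-side m []       _                 _ = inj₁ []
leaves-on-one-side m (x ∷ xs) (inj₁ refl , s) m∉ = inj₁ (n<1+n m ∷ stays-above xs s (n<1+n m) (All.tail m∉))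
leaves-on-one-side m (x ∷ xs) (inj₂ refl , s) m∉ = inj₂ (n<1+n x ∷ stays-below xs s (n<1+n x) (All.tail m∉))

Excursion : ℕ → List ℕ → Set
Excursion m E = Steps (m ∷ E ∷ʳ m) × (All (m <_) E ⊎ All (_< m) E)

Excursion⇒NonEmpty : ∀ {m E} → Excursion m E → E ≢ []
Excursion⇒NonEmpty (s , _) refl = Adjacent-irrefl (proj₁ s)

Excursion⇒Avoids : ∀ {m E} → Excursion m E → Avoids m E
Excursion⇒Avoids (_ , inj₁ above) = All.map (λ m<x x≡m → <⇒≢ m<x (sym x≡m)) above
Excursion⇒Avoids (_ , inj₂ below) = All.map <⇒≢ below

intermediate-value : ∀ {m a b} xs → Steps xs → a ∈ xs → b ∈ xs → a ≤ m → m ≤ b → ¬ Avoids m xs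
intermediate-value xs s a∈ b∈ a≤m m≤b m∉xs with stays-on-one-side xs s m∉xs
... | inj₁ m<xs = <⇒≱ (All.lookup m<xs a∈) a≤m
... | inj₂ xs<m = <⇒≱ (All.lookup xs<m b∈) m≤b

ends-below : ∀ {m} S → Steps (m ∷ S) → last (m ∷ S) ≡ just 0 → Avoids m S → All (_< m) S
ends-below []      _ _       _   = []
ends-below {m} (x ∷ S) s last≡0 m∉S with leaves-on-one-side m (x ∷ S) s m∉S
... | inj₁ m<S = contradiction (All.lookup m<S (last⇒∈ (x ∷ S) last≡0)) n≮0
... | inj₂ S<m = S<m

avoiding⇒Excursion : ∀ {m E} → Steps (m ∷ E ∷ʳ m) → Avoids m E → Excursion m E
avoiding⇒Excursion {m} {E} s m∉E = s , leaves-on-one-side m E (Steps-prefix (m ∷ E) [ m ] s) m∉E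

height≤ : ∀ {k} xs → All (_≤ k) xs → height xs ≤ k
height≤ []       []         = z≤n
height≤ (x ∷ xs) (x≤ ∷ xs≤) = ⊔-lub x≤ (height≤ xs xs≤)

height<  : ∀ {k} xs → 0 < k → All (_< k) xs → height xs < k
height< []       0<k []         = 0<k
height< (x ∷ xs) 0<k (x< ∷ xs<) = ⊔-lub x< (height< xs 0<k xs<)

≤height : ∀ xs → All (_≤ height xs) xs
≤height []       = []
≤height (x ∷ xs) = m≤m⊔n x (height xs) ∷ All.map (λ le → ≤-trans le (m≤n⊔m x (height xs))) (≤height xs)

∈⇒≤height : ∀ {v} xs → v ∈ xs → v ≤ height xs
∈⇒≤height xs v∈xs = All.lookup (≤height xs) v∈xs

height∈ : ∀ x xs → height (x ∷ xs) ∈ x ∷ xs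
height∈ x []       = here (⊔-identityʳ x)
height∈ x (y ∷ ys) with ⊔-sel x (height (y ∷ ys))
... | inj₁ eq = here eq
... | inj₂ eq = there (subst (_∈ y ∷ ys) (sym eq) (height∈ y ys))

height≡ : ∀ {k} xs → All (_≤ k) xs → k ∈ xs → height xs ≡ k
height≡ xs xs≤k k∈xs = ≤-antisym (height≤ xs xs≤k) (∈⇒≤height xs k∈xs)

height<⇒All< : ∀ {k} xs → height xs < k → All (_< k) xs
height<⇒All< xs lt = All.map (λ le → ≤-<-trans le lt) (≤height xs)

Dyck⇒height∈ : ∀ {d} → IsDyck d → height d ∈ d
Dyck⇒height∈ {x ∷ xs} _ = height∈ x xs

positionsFrom : (ℕ → Bool) → ℕ → List ℕ → List ℕ
positionsFrom p k []       = []
positionsFrom p k (x ∷ xs) = if p x then k ∷ positionsFrom p (suc k) xs else positionsFrom p (suc k) xs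

private
  positions≡ : ∀ p k (f : ℕ → ℕ) xs → (∀ i → f i ≡ k + i) →
               map proj₁ (filterᵇ (p ∘ proj₂) (zip (applyUpTo f (length xs)) xs)) ≡ positionsFrom p k xs
  positions≡ p k f []       f≗ = refl
  positions≡ p k f (x ∷ xs) f≗ with p x
  ... | true  = cong₂ _∷_ (trans (f≗ 0) (+-identityʳ k))
                          (positions≡ p (suc k) (f ∘ suc) xs (λ i → trans (f≗ (suc i)) (+-suc k i)))
  ... | false = positions≡ p (suc k) (f ∘ suc) xs (λ i → trans (f≗ (suc i)) (+-suc k i))

indicesWhere≡positionsFrom : ∀ p xs → indicesWhere p xs ≡ positionsFrom p 0 xs
indicesWhere≡positionsFrom p xs = positions≡ p 0 id xs (λ _ → refl)

positions-++ : ∀ p k xs {ys} → positionsFrom p k (xs ++ ys) ≡ positionsFrom p k xs ++ positionsFrom p (k + length xs) ys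
positions-++ p k []       rewrite +-identityʳ k = refl
positions-++ p k (x ∷ xs) rewrite +-suc k (length xs) with p x
... | true  = cong (k ∷_) (positions-++ p (suc k) xs)
... | false = positions-++ p (suc k) xs

positions-accept : ∀ p k {x} xs → T (p x) → positionsFrom p k (x ∷ xs) ≡ k ∷ positionsFrom p (suc k) xs
positions-accept p k {x} xs px with p x
... | true = refl

positions-reject : ∀ p k {x} xs → ¬ T (p x) → positionsFrom p k (x ∷ xs) ≡ positionsFrom p (suc k) xs
positions-reject p k {x} xs ¬px with p x
... | true  = contradiction tt ¬px
... | false = refl

positions-none : ∀ p k {xs} → All (¬_ ∘ T ∘ p) xs → positionsFrom p k xs ≡ []
positions-none p k []            = refl
positions-none p k {x ∷ xs} (¬px ∷ ¬pxs) = trans (positions-reject p k xs ¬px) (positions-none p (suc k) ¬pxs)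

positions< : ∀ p k xs → All (_< k + length xs) (positionsFrom p k xs)
positions< p k []       = []
positions< p k (x ∷ xs) rewrite +-suc k (length xs) with p x
... | true  = s≤s (m≤m+n k (length xs)) ∷ positions< p (suc k) xs
... | false = positions< p (suc k) xs

headOr0-positions : ∀ p k xs {ys} → Any (λ x → T (p x)) xs →
                    k ≤ headOr0 (positionsFrom p k xs ++ ys) × headOr0 (positionsFrom p k xs ++ ys) < k + length xs
headOr0-positions p k (x ∷ xs) (here px)  rewrite +-suc k (length xs) with p x
... | true  = ≤-refl , s≤s (m≤m+n k (length xs))
headOr0-positions p k (x ∷ xs) (there any) rewrite +-suc k (length xs) with p x
... | true  = ≤-refl , s≤s (m≤m+n k (length xs))
... | false = map₁ (≤-trans (n≤1+n k)) (headOr0-positions p (suc k) xs any)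

≢⇒¬T≡ᵇ : ∀ {x m} → x ≢ m → ¬ T (x ≡ᵇ m)
≢⇒¬T≡ᵇ {x} {m} x≢m t = x≢m (≡ᵇ⇒≡ x m t)

<⇒¬T≤ᵇ : ∀ {x y} → x < y → ¬ T (y ≤ᵇ x)
<⇒¬T≤ᵇ {x} {y} x<y t = <⇒≱ x<y (≤ᵇ⇒≤ y x t)

filterᵇ-keep-left : ∀ (q : ℕ → Bool) L {R} → All (T ∘ q) L → All (¬_ ∘ T ∘ q) R → filterᵇ q (L ++ R) ≡ L
filterᵇ-keep-left q L {R} qL ¬qR = begin
  filterᵇ q (L ++ R)             ≡⟨ filter-++ (T? ∘ q) L R ⟩
  filterᵇ q L ++ filterᵇ q R     ≡⟨ cong₂ _++_ (filter-all (T? ∘ q) qL) (filter-none (T? ∘ q) ¬qR) ⟩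
  L ++ []                        ≡⟨ ++-identityʳ L ⟩
  L                              ∎
  where open ≡-Reasoning

filterᵇ-keep-right : ∀ (q : ℕ → Bool) L {R} → All (¬_ ∘ T ∘ q) L → All (T ∘ q) R → filterᵇ q (L ++ R) ≡ R
filterᵇ-keep-right q L {R} ¬qL qR = begin
  filterᵇ q (L ++ R)             ≡⟨ filter-++ (T? ∘ q) L R ⟩
  filterᵇ q L ++ filterᵇ q R     ≡⟨ cong₂ _++_ (filter-none (T? ∘ q) ¬qL) (filter-all (T? ∘ q) qR) ⟩
  R                              ∎
  where open ≡-Reasoning

-- the positions of the m's in  m ∷ splice m Es S  when this list starts at position k
separatorPositions : ℕ → List (List ℕ) → List ℕ
separatorPositions k []       = [ k ]
separatorPositions k (E ∷ Es) = k ∷ separatorPositions (suc k + length E) Es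

private
  lastOr0-separators : ∀ k j Es → lastOr0 (k ∷ separatorPositions j Es) ≡ lastOr0 (separatorPositions j Es)
  lastOr0-separators k j []       = refl
  lastOr0-separators k j (E ∷ Es) = refl

  consecPairs-separators : ∀ k j Es →
                           consecPairs (k ∷ separatorPositions j Es) ≡ (k , j) ∷ consecPairs (separatorPositions j Es)
  consecPairs-separators k j []       = refl
  consecPairs-separators k j (E ∷ Es) = refl

∈-separators : ∀ k Es → k ∈ separatorPositions k Es
∈-separators k []       = here refl
∈-separators k (E ∷ Es) = here refl

separators-≥ : ∀ k Es → All (k ≤_) (separatorPositions k Es)
separators-≥ k []       = ≤-refl ∷ []
separators-≥ k (E ∷ Es) = ≤-refl ∷ All.map (≤-trans (m≤n⇒m≤1+n (m≤m+n k (length E)))) (separators-≥ (suc k + length E) Es)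

separators-≤ : ∀ k Es → All (_≤ lastOr0 (separatorPositions k Es)) (separatorPositions k Es)
separators-≤ k []       = ≤-refl ∷ []
separators-≤ k (E ∷ Es) rewrite lastOr0-separators k (suc k + length E) Es =
  ≤-trans (m≤n⇒m≤1+n (m≤m+n k (length E)))
          (All.lookup (separators-≤ (suc k + length E) Es) (∈-separators (suc k + length E) Es))
    ∷ separators-≤ (suc k + length E) Es

headOr0-separators : ∀ k Es → headOr0 (separatorPositions k Es) ≡ k
headOr0-separators k []       = refl
headOr0-separators k (E ∷ Es) = refl

positions-splice : ∀ m k Es {S} → All (Avoids m) Es → Avoids m S →
                   positionsFrom (_≡ᵇ m) k (m ∷ splice m Es S) ≡ separatorPositions k Es
positions-splice m k [] {S} [] m∉S =
  trans (positions-accept (_≡ᵇ m) k {m} S (≡⇒≡ᵇ m m refl))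
        (cong (k ∷_) (positions-none (_≡ᵇ m) (suc k) (All.map ≢⇒¬T≡ᵇ m∉S)))
positions-splice m k (E ∷ Es) {S} (m∉E ∷ m∉Es) m∉S = begin
  positionsFrom isM k (m ∷ E ++ m ∷ splice m Es S)
    ≡⟨ positions-accept isM k {m} (E ++ m ∷ splice m Es S) (≡⇒≡ᵇ m m refl) ⟩
  k ∷ positionsFrom isM (suc k) (E ++ m ∷ splice m Es S)
    ≡⟨ cong (k ∷_) (positions-++ isM (suc k) E) ⟩
  k ∷ positionsFrom isM (suc k) E ++ positionsFrom isM (suc k + length E) (m ∷ splice m Es S)
    ≡⟨ cong (λ xs → k ∷ xs ++ positionsFrom isM (suc k + length E) (m ∷ splice m Es S))
            (positions-none isM (suc k) (All.map ≢⇒¬T≡ᵇ m∉E)) ⟩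
  k ∷ positionsFrom isM (suc k + length E) (m ∷ splice m Es S)
    ≡⟨ cong (k ∷_) (positions-splice m (suc k + length E) Es m∉Es m∉S) ⟩
  separatorPositions k (E ∷ Es) ∎
  where open ≡-Reasoning
        isM = _≡ᵇ m

drop-after-separators : ∀ m Pre Es {S k} → length Pre ≡ k →
                        drop (suc (lastOr0 (separatorPositions k Es))) (Pre ++ m ∷ splice m Es S) ≡ S
drop-after-separators m Pre []             refl = drop-suc-length Pre
drop-after-separators m Pre (E ∷ Es) {S} refl
  rewrite lastOr0-separators (length Pre) (suc (length Pre) + length E) Es
        | sym (++-assoc Pre (m ∷ E) (m ∷ splice m Es S))
        = drop-after-separators m (Pre ++ m ∷ E) Es (length-++-∷ Pre E)

suc[n∸1]≡n : ∀ {n} → 0 < n → suc (n ∸ 1) ≡ n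
suc[n∸1]≡n {suc n} _ = refl

[1+n]-n≡1 : ∀ n → (+ suc n) ℤ.- (+ n) ≡ + 1
[1+n]-n≡1 n = trans (ℤ.m-n≡m⊖n (suc n) n) (trans (ℤ.⊖-≥ (n≤1+n n)) (cong +_ (m+n∸n≡m 1 n)))

n-[1+n]≡-1 : ∀ n → (+ n) ℤ.- (+ suc n) ≡ -[1+ 0 ]
n-[1+n]≡-1 n = trans (ℤ.m-n≡m⊖n n (suc n)) (trans (ℤ.⊖-< (n<1+n n)) (cong (λ k → ℤ.- (+ k)) (m+n∸n≡m 1 n)))

-- Coordinates relative to a level m.  lower is the map of d^fix and fold the map of d^spn;
-- encode E is the entry (ε_j, d^spn_j) of F for an excursion E between two consecutive ρ's.
module Level (m : ℕ) where

  lower raise reflect fold : ℕ → ℕ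
  lower   x = x ∸ suc m
  raise   x = x + suc m
  reflect x = m ∸ suc x
  fold    x = ∣ x - m ∣ ∸ 1

  lower-raise : ∀ x → lower (raise x) ≡ x
  lower-raise x = m+n∸n≡m x (suc m)

  raise-lower : ∀ {x} → m < x → raise (lower x) ≡ x
  raise-lower = m∸n+n≡m

  reflect-reflect : ∀ {x} → x < m → reflect (reflect x) ≡ x
  reflect-reflect {x} x<m = trans (cong (m ∸_) (sym (+-∸-assoc 1 x<m))) (m∸[m∸n]≡n (<⇒≤ x<m))

  reflect< : ∀ {x} → x < m → reflect x < m
  reflect< x<m = ∸-monoʳ-< z<s x<m

  fold-above : ∀ {x} → m < x → fold x ≡ lower x
  fold-above {x} m<x = begin
    ∣ x - m ∣ ∸ 1   ≡⟨ cong (_∸ 1) (m≤n⇒∣n-m∣≡n∸m (<⇒≤ m<x)) ⟩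
    x ∸ m ∸ 1       ≡⟨ ∸-+-assoc x m 1 ⟩
    x ∸ (m + 1)     ≡⟨ cong (x ∸_) (+-comm m 1) ⟩
    lower x         ∎
    where open ≡-Reasoning

  fold-below : ∀ {x} → x < m → fold x ≡ reflect x
  fold-below {x} x<m = begin
    ∣ x - m ∣ ∸ 1   ≡⟨ cong (_∸ 1) (m≤n⇒∣m-n∣≡n∸m (<⇒≤ x<m)) ⟩
    m ∸ x ∸ 1       ≡⟨ ∸-+-assoc m x 1 ⟩
    m ∸ (x + 1)     ≡⟨ cong (m ∸_) (+-comm x 1) ⟩
    reflect x       ∎
    where open ≡-Reasoning

  Adjacent-raise : ∀ {x y} → Adjacent x y → Adjacent (raise x) (raise y)
  Adjacent-raise (inj₁ refl) = inj₁ refl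
  Adjacent-raise (inj₂ refl) = inj₂ refl

  Adjacent-lower : ∀ {x y} → m < x → m < y → Adjacent x y → Adjacent (lower x) (lower y)
  Adjacent-lower m<x _   (inj₁ refl) = inj₁ (+-∸-assoc 1 m<x)
  Adjacent-lower _   m<y (inj₂ refl) = inj₂ (+-∸-assoc 1 m<y)

  Adjacent-reflect : ∀ {x y} → x < m → y < m → Adjacent x y → Adjacent (reflect x) (reflect y)
  Adjacent-reflect _   y<m (inj₁ refl) = inj₂ (+-∸-assoc 1 y<m)
  Adjacent-reflect x<m _   (inj₂ refl) = inj₁ (+-∸-assoc 1 x<m)

  excursion⇒Dyck : ∀ (f : ℕ → ℕ) {Q : ℕ → Set} →
                   (∀ {x y} → Q x → Q y → Adjacent x y → Adjacent (f x) (f y)) →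
                   (∀ {x} → Q x → Adjacent m x → f x ≡ 0) →
                   ∀ {E} → Steps (m ∷ E ∷ʳ m) → All Q E → IsDyck (map f E)
  excursion⇒Dyck f adj f≡0 {[]}    (m~m , _) _ = contradiction m~m Adjacent-irrefl
  excursion⇒Dyck f adj f≡0 {x ∷ E} (m~x , s) qs with Steps-∷ʳ⁻ x E s
  ... | sE , y , last≡y , y~m =
    cong just (f≡0 (All.head qs) m~x) ,
    trans (last-map f (x ∷ E)) (trans (cong (Maybe.map f) last≡y)
      (cong just (f≡0 (All.lookup qs (last⇒∈ (x ∷ E) last≡y)) (swap y~m)))) ,
    Steps-map f adj qs sE

  Dyck⇒excursion : ∀ (g : ℕ → ℕ) {Q : ℕ → Set} →
                   (∀ {x y} → Q x → Q y → Adjacent x y → Adjacent (g x) (g y)) →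
                   Adjacent m (g 0) → ∀ {p} → IsDyck p → All Q p → Steps (m ∷ map g p ∷ʳ m)
  Dyck⇒excursion g adj m~g0 {x ∷ p} (refl , last≡0 , s) qs =
    m~g0 , Steps-∷ʳ (map g (0 ∷ p)) (Steps-map g adj qs s)
             (trans (last-map g (0 ∷ p)) (cong (Maybe.map g) last≡0)) (swap m~g0)

  encode : List ℕ → ℤ × List ℕ
  encode E = (+ headOr0 E) ℤ.- (+ m) , map fold E

  decode : ℤ × List ℕ → List ℕ
  decode (+ _      , p) = map raise p
  decode (-[1+ _ ] , p) = map reflect p

  lower-Dyck : ∀ {X} → Steps (m ∷ X ∷ʳ m) → All (m <_) X → IsDyck (map lower X)
  lower-Dyck = excursion⇒Dyck lower Adjacent-lower
                 (λ m<x m~x → trans (cong lower (Adjacent-above m<x m~x)) (n∸n≡0 m))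

  reflect-Dyck : ∀ {E} → Steps (m ∷ E ∷ʳ m) → All (_< m) E → IsDyck (map reflect E)
  reflect-Dyck = excursion⇒Dyck reflect Adjacent-reflect
                   (λ {x} x<m m~x → trans (cong (_∸ suc x) (Adjacent-below x<m m~x)) (n∸n≡0 x))

  m<raise : ∀ x → m < raise x
  m<raise x = ≤-trans (n<1+n m) (m≤n+m (suc m) x)

  raise-excursion : ∀ {p} → IsDyck p → Excursion m (map raise p)
  raise-excursion {p} dp =
    Dyck⇒excursion raise (λ _ _ → Adjacent-raise) (inj₁ refl) dp (All.universal (λ _ → tt) p) ,
    inj₁ (All.map⁺ (All.universal m<raise p))

  reflect-excursion : ∀ {p} → IsDyck p → All (_< m) p → Excursion m (map reflect p)
  reflect-excursion {x ∷ p} dp@(refl , _) p<m =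
    Dyck⇒excursion reflect Adjacent-reflect (inj₂ (sym (suc[n∸1]≡n (All.head p<m)))) dp p<m ,
    inj₂ (All.map⁺ (All.map reflect< p<m))

  encode-above : ∀ {E} → Steps (m ∷ E ∷ʳ m) → All (m <_) E → encode E ≡ (+ 1 , map lower E)
  encode-above {[]}    (m~m , _) _   = contradiction m~m Adjacent-irrefl
  encode-above {x ∷ E} (m~x , _) m<E = cong₂ _,_
    (trans (cong (λ y → (+ y) ℤ.- (+ m)) (Adjacent-above (All.head m<E) m~x)) ([1+n]-n≡1 m))
    (map-cong-local (All.map fold-above m<E))

  encode-below : ∀ {E} → Steps (m ∷ E ∷ʳ m) → All (_< m) E → encode E ≡ (-[1+ 0 ] , map reflect E)
  encode-below {[]}    (m~m , _) _   = contradiction m~m Adjacent-irrefl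
  encode-below {x ∷ E} (m~x , _) E<m = cong₂ _,_
    (trans (cong (λ y → (+ x) ℤ.- (+ y)) (Adjacent-below (All.head E<m) m~x)) (n-[1+n]≡-1 x))
    (map-cong-local (All.map fold-below E<m))

  decode-encode : ∀ {E} → Excursion m E → decode (encode E) ≡ E
  decode-encode (s , inj₁ m<E) = trans (cong decode (encode-above s m<E)) (map-inverse raise-lower m<E)
  decode-encode (s , inj₂ E<m) = trans (cong decode (encode-below s E<m)) (map-inverse reflect-reflect E<m)

  map-lower-raise : ∀ p → map lower (map raise p) ≡ p
  map-lower-raise p = map-inverse (λ {x} _ → lower-raise x) (All.universal (λ _ → tt) p)

  encode-raise : ∀ {p} → IsDyck p → encode (map raise p) ≡ (+ 1 , p)
  encode-raise {p} dp = trans (encode-above (proj₁ (raise-excursion dp)) (All.map⁺ (All.universal m<raise p)))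
    (cong (+ 1 ,_) (map-lower-raise p))

  encode-reflect : ∀ {p} → IsDyck p → All (_< m) p → encode (map reflect p) ≡ (-[1+ 0 ] , p)
  encode-reflect dp p<m = trans (encode-below (proj₁ (reflect-excursion dp p<m)) (All.map⁺ (All.map reflect< p<m)))
    (cong (-[1+ 0 ] ,_) (map-inverse reflect-reflect p<m))

module _ (h : ℕ) where
  open Level ⌊ h /2⌋

  private
    m = ⌊ h /2⌋
    code : List ℕ → ℕ × ℕ → ℤ × List ℕ
    code d p = Decomp.eps h d p , Decomp.spn h d p

  code-excursion : ∀ d Pre E {T} → d ≡ Pre ++ m ∷ E ++ m ∷ T → E ≢ [] →
                   code d (length Pre , suc (length Pre + length E)) ≡ encode E
  code-excursion d Pre []      refl E≢[] = contradiction refl E≢[]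
  code-excursion d Pre (x ∷ E) {T} refl _ = cong₂ _,_
    (cong₂ (λ u v → (+ u) ℤ.- (+ v)) (cong headOr0 (drop-suc-length Pre)) (cong headOr0 (drop-length-++ Pre)))
    (cong (map fold) (slice-between Pre (x ∷ E)))

  codes-splice : ∀ d Pre Es {S k} → d ≡ Pre ++ m ∷ splice m Es S → length Pre ≡ k → All (_≢ []) Es →
                 map (code d) (consecPairs (separatorPositions k Es)) ≡ map encode Es
  codes-splice d Pre []           eq refl []             = refl
  codes-splice d Pre (E ∷ Es) {S} eq refl (E≢[] ∷ Es≢[]) = begin
    map (code d) (consecPairs (separatorPositions (length Pre) (E ∷ Es)))
      ≡⟨ cong (map (code d)) (consecPairs-separators (length Pre) _ Es) ⟩
    code d (length Pre , suc (length Pre + length E)) ∷ map (code d) (consecPairs (separatorPositions (suc (length Pre + length E)) Es))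
      ≡⟨ cong₂ _∷_ (code-excursion d Pre E eq E≢[])
                   (codes-splice d (Pre ++ m ∷ E) Es eq′ (length-++-∷ Pre E) Es≢[]) ⟩
    map encode (E ∷ Es) ∎
    where open ≡-Reasoning
          eq′ = trans eq (sym (++-assoc Pre (m ∷ E) (m ∷ splice m Es S)))

-- Since h ∉ P and h ∈ X, σmax lies inside X.  The m's of d are those of P ∷ʳ m, all before σmax,
-- and the separators, all after it; so σg = |P|, σd and σlast are the first and last separator,
-- and the ρ's are the separators.
module Shape (h : ℕ) {P X S : List ℕ} {Es : List (List ℕ)}
             (h∉P : Avoids h P) (h≢m : h ≢ ⌊ h /2⌋) (h∈X : h ∈ X) (m∉X : Avoids ⌊ h /2⌋ X)
             (m∉Es : All (Avoids ⌊ h /2⌋) Es) (Es≢[] : All (_≢ []) Es) (m∉S : Avoids ⌊ h /2⌋ S) where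
  open Level ⌊ h /2⌋ using (lower; encode)
  open ≡-Reasoning

  private
    m = ⌊ h /2⌋
    d = P ++ m ∷ X ++ m ∷ splice m Es S
    module D = Decomp h d
    isM = _≡ᵇ m
    isH = _≡ᵇ h
    c = suc (length P + length X)
    L = positionsFrom isM 0 P ∷ʳ length P
    R = separatorPositions c Es

    L≤ : All (_≤ length P) L
    L≤ = All.++⁺ (All.map <⇒≤ (positions< isM 0 P)) (≤-refl ∷ [])

    m-positions : D.mIdx ≡ L ++ R
    m-positions = begin
      indicesWhere isM d
        ≡⟨ indicesWhere≡positionsFrom isM d ⟩
      positionsFrom isM 0 d
        ≡⟨ positions-++ isM 0 P ⟩
      positionsFrom isM 0 P ++ positionsFrom isM (length P) (m ∷ X ++ m ∷ splice m Es S)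
        ≡⟨ cong (positionsFrom isM 0 P ++_) (positions-accept isM (length P) {m} (X ++ m ∷ splice m Es S) (≡⇒≡ᵇ m m refl)) ⟩
      positionsFrom isM 0 P ++ length P ∷ positionsFrom isM (suc (length P)) (X ++ m ∷ splice m Es S)
        ≡⟨ cong (λ is → positionsFrom isM 0 P ++ length P ∷ is) (positions-++ isM (suc (length P)) X) ⟩
      positionsFrom isM 0 P ++ length P ∷ positionsFrom isM (suc (length P)) X ++ positionsFrom isM c (m ∷ splice m Es S)
        ≡⟨ cong₂ (λ is js → positionsFrom isM 0 P ++ length P ∷ is ++ js)
                 (positions-none isM (suc (length P)) (All.map ≢⇒¬T≡ᵇ m∉X)) (positions-splice m c Es m∉Es m∉S) ⟩
      positionsFrom isM 0 P ++ length P ∷ R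
        ≡⟨ sym (++-assoc (positionsFrom isM 0 P) [ length P ] R) ⟩
      L ++ R ∎

    h-positions : indicesWhere isH d ≡ positionsFrom isH (suc (length P)) X ++ positionsFrom isH c (m ∷ splice m Es S)
    h-positions = begin
      indicesWhere isH d
        ≡⟨ indicesWhere≡positionsFrom isH d ⟩
      positionsFrom isH 0 d
        ≡⟨ positions-++ isH 0 P ⟩
      positionsFrom isH 0 P ++ positionsFrom isH (length P) (m ∷ X ++ m ∷ splice m Es S)
        ≡⟨ cong₂ _++_ (positions-none isH 0 (All.map ≢⇒¬T≡ᵇ h∉P))
                      (positions-reject isH (length P) {m} (X ++ m ∷ splice m Es S) (≢⇒¬T≡ᵇ (h≢m ∘ sym))) ⟩
      positionsFrom isH (suc (length P)) (X ++ m ∷ splice m Es S)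
        ≡⟨ positions-++ isH (suc (length P)) X ⟩
      positionsFrom isH (suc (length P)) X ++ positionsFrom isH c (m ∷ splice m Es S) ∎

    σmax-bounds : suc (length P) ≤ D.σmax × D.σmax < c
    σmax-bounds = subst (λ is → suc (length P) ≤ headOr0 is × headOr0 is < c) (sym h-positions)
                        (headOr0-positions isH (suc (length P)) X (Any.map (λ h≡x → ≡⇒≡ᵇ _ h (sym h≡x)) h∈X))

    L<c : All (_< c) L
    L<c = All.map (λ i≤P → s≤s (≤-trans i≤P (m≤m+n (length P) (length X)))) L≤

    L<σmax : All (_< D.σmax) L
    L<σmax = All.map (λ i≤P → <-≤-trans (s≤s i≤P) (proj₁ σmax-bounds)) L≤

    σmax<R : All (D.σmax <_) R
    σmax<R = All.map (<-≤-trans (proj₂ σmax-bounds)) (separators-≥ c Es)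

    after-σmax : filterᵇ (D.σmax ≤ᵇ_) D.mIdx ≡ R
    after-σmax = trans (cong (filterᵇ (D.σmax ≤ᵇ_)) m-positions) (filterᵇ-keep-right (D.σmax ≤ᵇ_) L
      (All.map <⇒¬T≤ᵇ L<σmax) (All.map (≤⇒≤ᵇ ∘ <⇒≤) σmax<R))

    σg≡ : D.σg ≡ length P
    σg≡ = begin
      lastOr0 (filterᵇ (_≤ᵇ D.σmax) D.mIdx)
        ≡⟨ cong (lastOr0 ∘ filterᵇ (_≤ᵇ D.σmax)) m-positions ⟩
      lastOr0 (filterᵇ (_≤ᵇ D.σmax) (L ++ R))
        ≡⟨ cong lastOr0 (filterᵇ-keep-left (_≤ᵇ D.σmax) L (All.map (≤⇒≤ᵇ ∘ <⇒≤) L<σmax)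
                                            (All.map <⇒¬T≤ᵇ σmax<R)) ⟩
      lastOr0 L
        ≡⟨ lastOr0-∷ʳ (positionsFrom isM 0 P) (length P) ⟩
      length P ∎

    σd≡ : D.σd ≡ c
    σd≡ = trans (cong headOr0 after-σmax) (headOr0-separators c Es)

    σlast≡ : D.σlast ≡ lastOr0 R
    σlast≡ = cong lastOr0 after-σmax

    ρs≡ : D.ρs ≡ R
    ρs≡ = begin
      filterᵇ (λ i → (D.σd ≤ᵇ i) ∧ (i ≤ᵇ D.σlast)) D.mIdx
        ≡⟨ cong₂ (λ a b → filterᵇ (λ i → (a ≤ᵇ i) ∧ (i ≤ᵇ b)) D.mIdx) σd≡ σlast≡ ⟩
      filterᵇ (λ i → (c ≤ᵇ i) ∧ (i ≤ᵇ lastOr0 R)) D.mIdx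
        ≡⟨ cong (filterᵇ (λ i → (c ≤ᵇ i) ∧ (i ≤ᵇ lastOr0 R))) m-positions ⟩
      filterᵇ (λ i → (c ≤ᵇ i) ∧ (i ≤ᵇ lastOr0 R)) (L ++ R)
        ≡⟨ filterᵇ-keep-right _ L (All.map (λ i<c → <⇒¬T≤ᵇ i<c ∘ proj₁ ∘ Equivalence.to T-∧) L<c)
                                  (All.zipWith (λ (c≤i , i≤l) → Equivalence.from T-∧ (≤⇒≤ᵇ c≤i , ≤⇒≤ᵇ i≤l))
                                               (separators-≥ c Es , separators-≤ c Es)) ⟩
      R ∎

  F-shape : F h d ≡ (map lower X , P ++ m ∷ S , map encode Es)
  F-shape = cong₂ _,_ dfix≡ (cong₂ _,_ dfree≡ excursions≡)
    where
    d≡ : d ≡ (P ++ m ∷ X) ++ m ∷ splice m Es S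
    d≡ = sym (++-assoc P (m ∷ X) (m ∷ splice m Es S))

    dfix≡ : D.dfix ≡ map lower X
    dfix≡ = cong (map lower) (trans (cong₂ (λ a b → slice d (suc a) (b ∸ 1)) σg≡ σd≡) (slice-between P X))

    dfree≡ : D.dfree ≡ P ++ m ∷ S
    dfree≡ = begin
      slice d 0 D.σg ++ drop (suc D.σlast) d
        ≡⟨ cong₂ (λ a b → slice d 0 a ++ drop (suc b) d) σg≡ σlast≡ ⟩
      take (suc (length P)) d ++ drop (suc (lastOr0 R)) d
        ≡⟨ cong₂ _++_ (take-suc-length P) (trans (cong (drop (suc (lastOr0 R))) d≡)
                                                 (drop-after-separators m (P ++ m ∷ X) Es (length-++-∷ P X))) ⟩
      P ∷ʳ m ++ S
        ≡⟨ ++-assoc P [ m ] S ⟩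
      P ++ m ∷ S ∎

    excursions≡ : D.excursions ≡ map encode Es
    excursions≡ = trans (cong (map (λ p → D.eps p , D.spn p) ∘ consecPairs) ρs≡)
                        (codes-splice h d (P ++ m ∷ X) Es d≡ (length-++-∷ P X) Es≢[])

1≤n⇒⌊n/2⌋<n : ∀ {n} → 1 ≤ n → ⌊ n /2⌋ < n
1≤n⇒⌊n/2⌋<n {suc n} _ = ⌊n/2⌋<n n

n∸⌊n/2⌋≡⌈n/2⌉ : ∀ n → n ∸ ⌊ n /2⌋ ≡ ⌈ n /2⌉
n∸⌊n/2⌋≡⌈n/2⌉ n = trans (cong (_∸ ⌊ n /2⌋) (sym (⌊n/2⌋+⌈n/2⌉≡n n))) (m+n∸m≡n ⌊ n /2⌋ ⌈ n /2⌉)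

module Bijection (h : ℕ) (1≤h : 1 ≤ h) where
  open Level ⌊ h /2⌋

  private
    m = ⌊ h /2⌋

    m<h : m < h
    m<h = 1≤n⇒⌊n/2⌋<n 1≤h

    h≢m : h ≢ m
    h≢m h≡m = <⇒≢ m<h (sym h≡m)

    -- the largest height of d^fix
    room : ℕ
    room = h ∸ suc m

    room≡ : h ∸ m ∸ 1 ≡ room
    room≡ = trans (∸-+-assoc h m 1) (cong (h ∸_) (+-comm m 1))

    suc-room≡⌈h/2⌉ : suc room ≡ ⌈ h /2⌉
    suc-room≡⌈h/2⌉ = trans (sym (+-∸-assoc 1 m<h)) (n∸⌊n/2⌋≡⌈n/2⌉ h)

    lower≤room : ∀ {x} → x ≤ h → lower x ≤ room
    lower≤room = ∸-monoˡ-≤ (suc m)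

    raise≤h : ∀ {x} → x ≤ room → raise x ≤ h
    raise≤h {x} = m≤o∸n⇒m+n≤o x m<h

    ≤room⇒<⌈h/2⌉ : ∀ {x} → x ≤ room → x < ⌈ h /2⌉
    ≤room⇒<⌈h/2⌉ {x} x≤room = subst (x <_) suc-room≡⌈h/2⌉ (s≤s x≤room)

    <⌈h/2⌉⇒≤room : ∀ {x} → x < ⌈ h /2⌉ → x ≤ room
    <⌈h/2⌉⇒≤room {x} x<⌈h/2⌉ = s≤s⁻¹ (subst (x <_) (sym suc-room≡⌈h/2⌉) x<⌈h/2⌉)

    raise-room : raise room ≡ h
    raise-room = m∸n+n≡m m<h

  -- P ∷ʳ m is d on [0, σg], X is d on ]σg, σd[, the Es are the stretches between consecutive ρ's,
  -- and S is d on ]σlast, 2n].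
  record Decomposition (d : List ℕ) : Set where
    field
      P X S : List ℕ
      Es : List (List ℕ)
      shape : d ≡ P ++ m ∷ X ++ m ∷ splice m Es S
      free-Dyck : IsDyck (P ++ m ∷ S)
      P<h : All (_< h) P
      S<m : All (_< m) S
      X-steps : Steps (m ∷ X ∷ʳ m)
      m<X : All (m <_) X
      X≤h : All (_≤ h) X
      h∈X : h ∈ X
      Es-excursions : All (Excursion m) Es
      Es≤h : All (All (_≤ h)) Es

  F-decomposition : ∀ {d} (D : Decomposition d) → let open Decomposition D in
                    F h d ≡ (map lower X , P ++ m ∷ S , map encode Es)
  F-decomposition D = trans (cong (F h) shape)
    (Shape.F-shape h (All.map <⇒≢ P<h) h≢m h∈X (All.map (λ m<x x≡m → <⇒≢ m<x (sym x≡m)) m<X)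
                     (All.map Excursion⇒Avoids Es-excursions) (All.map Excursion⇒NonEmpty Es-excursions)
                     (All.map <⇒≢ S<m))
    where open Decomposition D

  Decomposition⇒InD : ∀ {d} → Decomposition d → InD h d
  Decomposition⇒InD D rewrite Decomposition.shape D =
    (head≡0 , last≡0 , steps) , height≡ d d≤h (∈-++⁺ʳ P (there (∈-++⁺ˡ h∈X)))
    where
    open Decomposition D hiding (shape)
    d = P ++ m ∷ X ++ m ∷ splice m Es S
    free-steps = Steps-++⁻ P S (proj₂ (proj₂ free-Dyck))
    head≡0 = trans (head-++-∷ P _ S) (proj₁ free-Dyck)
    last≡0 = trans (last-++-∷ P _) (trans (last-++-∷ (m ∷ X) _) (trans (last-splice m Es S)
               (trans (sym (last-++-∷ P S)) (proj₁ (proj₂ free-Dyck)))))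
    steps = Steps-++⁺ P _ (proj₁ free-steps) (Steps-++⁺ (m ∷ X) _ X-steps
              (Steps-splice⁺ m Es (All.map proj₁ Es-excursions) (proj₂ free-steps)))
    d≤h : All (_≤ h) d
    d≤h = All.++⁺ (All.map <⇒≤ P<h) (<⇒≤ m<h ∷ All.++⁺ X≤h (<⇒≤ m<h ∷
            All-splice⁺ (<⇒≤ m<h) Es≤h (All.map (λ x<m → <⇒≤ (<-trans x<m m<h)) S<m)))

  private
    decompose : ∀ P X R → IsDyck (P ++ m ∷ X ++ m ∷ R) → All (_≤ h) (P ++ m ∷ X ++ m ∷ R) →
                Avoids h P → h ∈ X → Avoids m X → Decomposition (P ++ m ∷ X ++ m ∷ R)
    decompose P X R (head≡0 , last≡0 , steps) d≤h h∉P h∈X m∉X with splitOn _≟_ m R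
    ... | Es , S , refl , m∉Es , m∉S = record
      { P = P ; X = X ; S = S ; Es = Es ; shape = refl
      ; free-Dyck = trans (head-++-∷ P _ _) head≡0 , trans (last-++-∷ P S) last-S≡0 , Steps-++⁺ P S steps-P steps-S
      ; P<h = All.zipWith (λ (x≤h , x≢h) → ≤∧≢⇒< x≤h x≢h) (P≤h , h∉P)
      ; S<m = ends-below S steps-S last-S≡0 m∉S
      ; X-steps = steps-X
      ; m<X = m<X
      ; X≤h = X≤h
      ; h∈X = h∈X
      ; Es-excursions = All.zipWith (λ (s , m∉E) → avoiding⇒Excursion s m∉E) (steps-Es , m∉Es)
      ; Es≤h = proj₁ (All-splice⁻ m Es splice≤h)
      }
      where
      steps-P = proj₁ (Steps-++⁻ P _ steps)
      steps-X = proj₁ (Steps-++⁻ (m ∷ X) _ (proj₂ (Steps-++⁻ P _ steps)))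
      steps-splice = Steps-splice⁻ m Es (proj₂ (Steps-++⁻ (m ∷ X) _ (proj₂ (Steps-++⁻ P _ steps))))
      steps-Es = proj₁ steps-splice
      steps-S = proj₂ steps-splice
      last-S≡0 = trans (sym (last-splice m Es S)) (trans (sym (last-++-∷ (m ∷ X) _)) (trans (sym (last-++-∷ P _)) last≡0))
      P≤h = All.++⁻ˡ P d≤h
      X≤h = All.++⁻ˡ X (All.tail (All.++⁻ʳ P d≤h))
      splice≤h = All.tail (All.++⁻ʳ X (All.tail (All.++⁻ʳ P d≤h)))
      m<X : All (m <_) X
      m<X with leaves-on-one-side m X (Steps-prefix (m ∷ X) [ m ] steps-X) m∉X
      ... | inj₁ above = above
      ... | inj₂ X<m   = contradiction (All.lookup X<m h∈X) (<-asym m<h)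

  -- Split d at its first h, then at the last m before it and the first m after it.
  InD⇒Decomposition : ∀ {d} → InD h d → Decomposition d
  InD⇒Decomposition {d} (dyck@(head≡0 , last≡0 , steps) , height≡h) with splitFirst _≟_ h d
  ... | inj₁ h∉d = ⊥-elim (All.lookup h∉d (subst (_∈ d) height≡h (Dyck⇒height∈ dyck)) refl)
  ... | inj₂ (A , B , refl , h∉A) with splitLast _≟_ m A
  ...   | inj₁ m∉A = ⊥-elim (intermediate-value (A ∷ʳ h) (proj₁ (Steps-++⁻ A B steps))
            (head⇒∈ (A ∷ʳ h) (trans (head-++-∷ A [] B) head≡0)) (∈-++⁺ʳ A (here refl)) z≤n (<⇒≤ m<h)
            (All.++⁺ m∉A (h≢m ∷ [])))
  ...   | inj₂ (P , X₁ , refl , m∉X₁) with splitFirst _≟_ m B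
  ...     | inj₁ m∉B = ⊥-elim (intermediate-value (h ∷ B) (proj₂ (Steps-++⁻ (P ++ m ∷ X₁) B steps))
              (last⇒∈ (h ∷ B) (trans (sym (last-++-∷ (P ++ m ∷ X₁) B)) last≡0)) (here refl) z≤n (<⇒≤ m<h)
              (h≢m ∷ m∉B))
  ...     | inj₂ (X₂ , R , refl , m∉X₂) = subst Decomposition (sym d≡)
              (decompose P (X₁ ++ h ∷ X₂) R (subst IsDyck d≡ dyck) (subst (All (_≤ h)) d≡ d≤h)
                         (All.++⁻ˡ P h∉A) (∈-++⁺ʳ X₁ (here refl)) (All.++⁺ m∉X₁ (h≢m ∷ m∉X₂)))
    where
    d≡ : (P ++ m ∷ X₁) ++ h ∷ X₂ ++ m ∷ R ≡ P ++ m ∷ (X₁ ++ h ∷ X₂) ++ m ∷ R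
    d≡ = trans (++-assoc P (m ∷ X₁) (h ∷ X₂ ++ m ∷ R))
               (cong (λ Y → P ++ m ∷ Y) (sym (++-assoc X₁ (h ∷ X₂) (m ∷ R))))
    d≤h = subst (λ k → All (_≤ k) ((P ++ m ∷ X₁) ++ h ∷ X₂ ++ m ∷ R)) height≡h (≤height _)

  encode∈Letter : ∀ {E} → Excursion m E → All (_≤ h) E → InLetter h (encode E)
  encode∈Letter {[]}    e                _   = contradiction refl (Excursion⇒NonEmpty e)
  encode∈Letter {x ∷ E} (s , inj₁ m<E) E≤h = subst (InLetter h) (sym (encode-above s m<E))
    (inj₂ (refl , lower-Dyck s m<E ,
           height< _ (≤room⇒<⌈h/2⌉ z≤n) (All.map⁺ (All.map (≤room⇒<⌈h/2⌉ ∘ lower≤room) E≤h))))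
  encode∈Letter {x ∷ E} (s , inj₂ E<m) _   = subst (InLetter h) (sym (encode-below s E<m))
    (inj₁ (refl , reflect-Dyck s E<m , height< _ (≤-<-trans z≤n (All.head E<m)) (All.map⁺ (All.map reflect< E<m))))

  F∈D′ : ∀ {d} → Decomposition d → InD' h (F h d)
  F∈D′ D = subst (InD' h) (sym (F-decomposition D))
    ( (lower-Dyck X-steps m<X , trans (height≡ (map lower X) lower≤ (∈-map⁺ lower h∈X)) (sym room≡))
    , (free-Dyck , ∈⇒≤height (P ++ m ∷ S) (∈-++⁺ʳ P (here refl)) ,
       height< (P ++ m ∷ S) (≤-<-trans z≤n m<h) (All.++⁺ P<h (m<h ∷ All.map (λ x<m → <-trans x<m m<h) S<m)))
    , All.map⁺ (All.zipWith (λ (e , E≤h) → encode∈Letter e E≤h) (Es-excursions , Es≤h)))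
    where
    open Decomposition D
    lower≤ : All (_≤ lower h) (map lower X)
    lower≤ = All.map⁺ (All.map (∸-monoˡ-≤ (suc m)) X≤h)

  F-injective : ∀ {d d′} → Decomposition d → Decomposition d′ → F h d ≡ F h d′ → d ≡ d′
  F-injective D D′ eq = begin
    _                                            ≡⟨ D.shape ⟩
    D.P ++ m ∷ D.X ++ m ∷ splice m D.Es D.S      ≡⟨ cong₂ (λ (P , S) (X , Es) → P ++ m ∷ X ++ m ∷ splice m Es S)
                                                          (cong₂ _,_ (proj₁ PS≡) (proj₂ PS≡)) (cong₂ _,_ X≡ Es≡) ⟩
    D′.P ++ m ∷ D′.X ++ m ∷ splice m D′.Es D′.S  ≡⟨ sym D′.shape ⟩
    _                                            ∎
    where
    open ≡-Reasoning
    module D  = Decomposition D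
    module D′ = Decomposition D′
    images = trans (sym (F-decomposition D)) (trans eq (F-decomposition D′))
    X≡  = map-cancel {g = raise} raise-lower D.m<X D′.m<X (cong proj₁ images)
    PS≡ = ++-∷-injective-avoiding D.P D.S D′.P D′.S (cong (proj₁ ∘ proj₂) images)
            (All.map <⇒≢ D.S<m) (All.map <⇒≢ D′.S<m)
    Es≡ = map-cancel {g = decode} decode-encode D.Es-excursions D′.Es-excursions (cong (proj₂ ∘ proj₂) images)

  decode∈ : ∀ {w} → InLetter h w → Excursion m (decode w) × All (_≤ h) (decode w)
  decode∈ {_ , p} (inj₁ (refl , p-Dyck , p<m)) =
    reflect-excursion p-Dyck (height<⇒All< p p<m) ,
    All.map⁺ (All.map (λ x<m → <⇒≤ (<-trans (reflect< x<m) m<h)) (height<⇒All< p p<m))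
  decode∈ {_ , p} (inj₂ (refl , p-Dyck , p<⌈h/2⌉)) =
    raise-excursion p-Dyck ,
    All.map⁺ (All.map (raise≤h ∘ <⌈h/2⌉⇒≤room) (height<⇒All< p p<⌈h/2⌉))

  encode-decode : ∀ {w} → InLetter h w → encode (decode w) ≡ w
  encode-decode {_ , p} (inj₁ (refl , p-Dyck , p<m)) = encode-reflect p-Dyck (height<⇒All< p p<m)
  encode-decode {_ , p} (inj₂ (refl , p-Dyck , _))   = encode-raise p-Dyck

  F-surjective : ∀ t → InD' h t → Σ[ d ∈ List ℕ ] InD h d × F h d ≡ t
  F-surjective (fx , fr , ws) ((fx-Dyck , fx-height) , (fr-Dyck , m≤fr , fr<h) , ws∈)
    with splitLast _≟_ m fr
  ... | inj₁ m∉fr = ⊥-elim (intermediate-value fr (proj₂ (proj₂ fr-Dyck)) (head⇒∈ fr (proj₁ fr-Dyck))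
                                               (Dyck⇒height∈ fr-Dyck) z≤n m≤fr m∉fr)
  ... | inj₂ (P , S , refl , m∉S) =
    _ , Decomposition⇒InD D , trans (F-decomposition D) (cong₂ _,_ (map-lower-raise fx) (cong (P ++ m ∷ S ,_) letters≡))
    where
    fr-steps = Steps-++⁻ P S (proj₂ (proj₂ fr-Dyck))
    fx≤room : All (_≤ room) fx
    fx≤room = subst (λ k → All (_≤ k) fx) (trans fx-height room≡) (≤height fx)
    D : Decomposition (P ++ m ∷ map raise fx ++ m ∷ splice m (map decode ws) S)
    D = record
      { P = P ; X = map raise fx ; S = S ; Es = map decode ws ; shape = refl
      ; free-Dyck = fr-Dyck
      ; P<h = All.++⁻ˡ P (height<⇒All< _ fr<h)
      ; S<m = ends-below S (proj₂ fr-steps) (trans (sym (last-++-∷ P S)) (proj₁ (proj₂ fr-Dyck))) m∉S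
      ; X-steps = proj₁ (raise-excursion fx-Dyck)
      ; m<X = All.map⁺ (All.universal m<raise fx)
      ; X≤h = All.map⁺ (All.map raise≤h fx≤room)
      ; h∈X = subst (_∈ map raise fx) (trans (cong raise (trans fx-height room≡)) raise-room)
                    (∈-map⁺ raise (Dyck⇒height∈ fx-Dyck))
      ; Es-excursions = All.map⁺ (All.map (proj₁ ∘ decode∈) ws∈)
      ; Es≤h = All.map⁺ (All.map (proj₂ ∘ decode∈) ws∈)
      }
    letters≡ : map encode (map decode ws) ≡ ws
    letters≡ = map-inverse encode-decode ws∈

lemma3p4 : (h : ℕ) → 1 ≤ h →
    ((d : List ℕ) → InD h d → InD' h (F h d))
    × ((d d′ : List ℕ) → InD h d → InD h d′ → F h d ≡ F h d′ → d ≡ d′)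
    × ((t : List ℕ × List ℕ × List (ℤ × List ℕ)) → InD' h t →
         Σ (List ℕ) (λ d → InD h d × F h d ≡ t))
lemma3p4 h 1≤h =
  (λ d d∈ → F∈D′ (InD⇒Decomposition d∈)) ,
  (λ d d′ d∈ d′∈ → F-injective (InD⇒Decomposition d∈) (InD⇒Decomposition d′∈)) ,
  F-surjective
  where open Bijection h 1≤h
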